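{- Let $G$ be a graph, $d,L\in\mathbb N$, and $\ell_G\colon V(G)\to[L]\cup\{\infty\}$ such that for every $v$ with $\ell_G(v)\ne\infty$, $|\{u\in N_G(v):\ell_G(u)\ge\ell_G(v)\}|\le d$. Let $B,k,s\in\mathbb N_0$ with $k\ge d$ and $s>\log_2 L$. Let $v\in V(G)$ with $\ell_G(v)\ne\infty$ and $\mathrm{NumPathsIn}_{G,\ell_G}(v)\le\sqrt B$. Let $T^{(s)}_v,\mathrm{map}^{(s)}_v$ be obtained from $\mathrm{ExponentiateAndLocalPrune}(G,B,k,s)$, and let $\ell_v$ be the output of $\mathrm{PartialLayerAssignmentTree}(G,T^{(s)}_v,\mathrm{map}^{(s)}_v,k(s+1),L)$. Then, with $r_v$ the root of $T^{(s)}_v$, $\ell_v(r_v)\le\ell_G(v)$.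
   Context: $[L]=\{1,\dots,L\}$, $\infty$ exceeds every integer. A path $(v_1,\dots,v_k)$ ($k\ge1$) is strictly increasing w.r.t. $\ell_G$ if $\ell_G(v_1)<\dots<\ell_G(v_k)<\infty$; $\mathrm{NumPathsIn}_{G,\ell_G}(v)$ is the number of distinct strictly increasing paths ending at $v$. For a rooted tree $T$ with $\mathrm{map}\colon V(T)\to V(G)$: $\mathrm{Missing}(x)=N_G(\mathrm{map}(x))\setminus\{\mathrm{map}(c):c\text{ child of }x\}$. $\mathrm{LocalPrune}(T,k)$, root $r$: if $r$ has at most $k$ children, return $\{r\}$; otherwise for each child $c$ compute $\mathrm{LocalPrune}(T_c,k)$ ($T_c$ the subtree rooted at $c$), discard the $k$ largest of these (by node count, ties arbitrary), and return $r$ with the remaining pruned subtrees as child subtrees; mappings are restricted. $\mathrm{ExponentiateAndLocalPrune}(G,B,k,s)$: Initialization: for each $v$ with $|N_G(v)|<B$, $T^{(0)}_v$ is a root mapped to $v$ with one child mapped to each neighbor of $v$, and $v$ is active; for each $v$ with $|N_G(v)|\ge B$, $T^{(0)}_v$ is a single node mapped to $v$ and $v$ is inactive. For $i=1,\dots,s$: (Prune step) for every $v$, $T^{(i-1)}_{v,\mathrm{pruned}}=\mathrm{LocalPrune}(T^{(i-1)}_v,k)$ with restricted mapping; if $|V(T^{(i-1)}_{v,\mathrm{pruned}})|>\sqrt B$, mark $v$ inactive (permanently). (Attachment step, after pruning all $v$) for every $v$: if $v$ is inactive, $T^{(i)}_v=T^{(i-1)}_{v,\mathrm{pruned}}$;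 otherwise let $x_1,\dots,x_\eta$ be the leaves of $T^{(i-1)}_{v,\mathrm{pruned}}$ at distance exactly $2^{i-1}$ from the root that map to an active vertex and replace each $x_j$ by a fresh copy of $T^{(i-1)}_{u_j,\mathrm{pruned}}$, $u_j$ the image of $x_j$ (the copy's root takes the place of $x_j$), mapping inherited. $\mathrm{PartialLayerAssignmentTree}(G,T,\mathrm{map},a,L)$: $V_{\ge1}=V(T)$; for $j=1,\dots,L$: $V_j=\{x\in V_{\ge j}:|\mathrm{children}_T(x)\cap V_{\ge j}|+|\mathrm{Missing}(x)|\le a\}$, $\ell_T(x)=j$ for $x\in V_j$, $V_{\ge j+1}=V_{\ge j}\setminus V_j$; finally $\ell_T(x)=\infty$ on $V_{\ge L+1}$. -}

module Defs where

open import Data.Nat using (ℕ; zero; suc; _+_; _*_; _^_; _≤_; _<_; _≤ᵇ_; _<ᵇ_)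
open import Data.Bool using (Bool; true; false; _∧_; not; if_then_else_)
open import Data.Fin using (Fin; _≟_)
open import Data.List using (List; []; _∷_; _++_; [_]; length; map; filterᵇ; allFin)
open import Data.Bool.ListAction using (any)
open import Data.List.Relation.Unary.Linked using (Linked)
open import Data.List.Relation.Unary.Unique.Propositional using (Unique)
open import Data.List.Relation.Binary.Pointwise using (Pointwise)
open import Data.List.Relation.Binary.Permutation.Propositional using (_↭_)
open import Data.List.Relation.Unary.All using (All)
open import Data.List.Membership.Propositional using (_∈_)
open import Data.Product using (Σ; ∃; _×_; _,_)
open import Relation.Nullary using (does)
open import Relation.Binary.PropositionalEquality using (_≡_)
open import Function.Bundles using (_⇔_)
open import Data.Unit using (⊤)
open import Data.Empty using (⊥)

record Graph : Set where
  field
    n      : ℕ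
    adj    : Fin n → Fin n → Bool
    sym    : ∀ u v → adj u v ≡ adj v u
    irrefl : ∀ v → adj v v ≡ false
open Graph public

V : Graph → Set
V G = Fin (n G)

nbrs : (G : Graph) → V G → List (V G)
nbrs G v = filterᵇ (adj G v) (allFin (n G))

-- ℕ ∪ {∞}  (layers are fin 1 … fin L, or ∞)

data ℕ∞ : Set where
  fin : ℕ → ℕ∞
  ∞   : ℕ∞

_≤∞_ : ℕ∞ → ℕ∞ → Set
fin a ≤∞ fin b = a ≤ b
fin a ≤∞ ∞     = ⊤
∞     ≤∞ fin b = ⊥
∞     ≤∞ ∞     = ⊤

_<∞_ : ℕ∞ → ℕ∞ → Set
fin a <∞ fin b = a < b
fin a <∞ ∞     = ⊤
∞     <∞ _     = ⊥

_≤∞ᵇ_ : ℕ∞ → ℕ∞ → Bool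
fin a ≤∞ᵇ fin b = a ≤ᵇ b
fin a ≤∞ᵇ ∞     = true
∞     ≤∞ᵇ fin b = false
∞     ≤∞ᵇ ∞     = true

IncStep : (G : Graph) → (V G → ℕ∞) → V G → V G → Set
IncStep G ℓ x y = (adj G x y ≡ true) × (ℓ x <∞ ℓ y)

IsIncPathTo : (G : Graph) → (V G → ℕ∞) → List (V G) → V G → Set
IsIncPathTo G ℓ p v =
  (∃ λ q → p ≡ q ++ [ v ]) × Linked (IncStep G ℓ) p × (ℓ v <∞ ∞)

-- NumPathsIn_{G,ℓ}(v) = N : there is a duplicate-free list of exactly the
-- strictly increasing paths ending at v, and it has length N.
NumPathsIn≡ : (G : Graph) → (V G → ℕ∞) → V G → ℕ → Set
NumPathsIn≡ G ℓ v N =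
  Σ (List (List (V G))) λ ps →
    Unique ps × (∀ p → (p ∈ ps) ⇔ IsIncPathTo G ℓ p v) × (length ps ≡ N)

-- Rooted trees whose nodes are mapped to vertices (node label = map)

data Tree (m : ℕ) : Set where
  node : Fin m → List (Tree m) → Tree m

root : ∀ {m} → Tree m → Fin m
root (node u _) = u

children : ∀ {m} → Tree m → List (Tree m)
children (node _ cs) = cs

mutual
  size : ∀ {m} → Tree m → ℕ
  size (node _ cs) = suc (sizes cs)

  sizes : ∀ {m} → List (Tree m) → ℕ
  sizes []       = 0
  sizes (c ∷ cs) = size c + sizes cs

-- LocalPrune(T,k) as a relation (ties are broken arbitrarily)

data LocalPrune {m : ℕ} (k : ℕ) : Tree m → Tree m → Set where
  few  : ∀ {u cs} → length cs ≤ k → LocalPrune k (node u cs) (node u [])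
  many : ∀ {u cs ps kept disc} →
         k < length cs →
         Pointwise (LocalPrune k) cs ps →
         ps ↭ (kept ++ disc) →
         length disc ≡ k →
         All (λ d → All (λ e → size e ≤ size d) kept) disc →  -- the k largest
         LocalPrune k (node u cs) (node u kept)

initTree : (G : Graph) → ℕ → V G → Tree (n G)
initTree G B v =
  if length (nbrs G v) <ᵇ B
  then node v (map (λ u → node u []) (nbrs G v))
  else node v []

initActive : (G : Graph) → ℕ → V G → Bool
initActive G B v = length (nbrs G v) <ᵇ B

-- activity after the prune step: inactive if |V(pruned)| > √B, i.e. |V|² > B
newActive : (G : Graph) → ℕ → (V G → Bool) → (V G → Tree (n G)) → V G → Bool
newActive G B act P v = act v ∧ not (B <ᵇ size (P v) * size (P v))

mutual
  attach : ∀ {m} → (Fin m → Bool) → (Fin m → Tree m) → ℕ → Tree m → Tree m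
  attach act P zero (node u [])       = if act u then P u else node u []
  attach act P zero (node u (c ∷ cs)) = node u (c ∷ cs)
  attach act P (suc d) (node u cs)    = node u (attachs act P d cs)

  attachs : ∀ {m} → (Fin m → Bool) → (Fin m → Tree m) → ℕ → List (Tree m) → List (Tree m)
  attachs act P d []       = []
  attachs act P d (c ∷ cs) = attach act P d c ∷ attachs act P d cs

-- ExpLP G B k i Ts act : (Ts, act) is a possible state (trees T^{(i)}_v and
-- active flags) after i iterations of ExponentiateAndLocalPrune(G,B,k,·)
data ExpLP (G : Graph) (B k : ℕ) : ℕ → (V G → Tree (n G)) → (V G → Bool) → Set where
  init : ExpLP G B k 0 (initTree G B) (initActive G B)
  step : ∀ {i Ts act} → ExpLP G B k i Ts act →
         (P : V G → Tree (n G)) → (∀ v → LocalPrune k (Ts v) (P v)) →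
         ExpLP G B k (suc i)
           (λ v → if newActive G B act P v
                  then attach (newActive G B act P) P (2 ^ i) (P v)
                  else P v)
           (newActive G B act P)

-- PartialLayerAssignmentTree(G,T,map,a,L), evaluated at the root.
-- geq a j x  ⇔  x ∈ V_{≥ j+1};  inV a j x ⇔ x satisfies the V_{j+1} condition.

missing : (G : Graph) → Tree (n G) → ℕ
missing G (node u cs) =
  length (filterᵇ (λ w → not (any (λ c → does (root c ≟ w)) cs)) (nbrs G u))

mutual
  geq : (G : Graph) → ℕ → ℕ → Tree (n G) → Bool
  geq G a zero    x = true
  geq G a (suc j) x = geq G a j x ∧ not (inV G a j x)

  inV : (G : Graph) → ℕ → ℕ → Tree (n G) → Bool
  inV G a j (node u cs) = (countGeq G a j cs + missing G (node u cs)) ≤ᵇ a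

  countGeq : (G : Graph) → ℕ → ℕ → List (Tree (n G)) → ℕ
  countGeq G a j []       = 0
  countGeq G a j (c ∷ cs) = (if geq G a j c then 1 else 0) + countGeq G a j cs

layerAux : (G : Graph) → ℕ → Tree (n G) → ℕ → ℕ → ℕ∞
layerAux G a x j zero = ∞
layerAux G a x j (suc f) =
  if geq G a j x ∧ inV G a j x then fin (suc j) else layerAux G a x (suc j) f

layer : (G : Graph) → (a L : ℕ) → Tree (n G) → ℕ∞
layer G a L x = layerAux G a x 0 L

-- Say u has few paths if NumPathsIn(u) ≤ √B; then so do its down-neighbours (smaller label).
-- Pruning the tree of such a u leaves at most NumPathsIn(u) nodes: at most d ≤ k children of a
-- node are up-neighbours, so the k discarded subtrees outweigh the kept up-subtrees, and the
-- down-subtrees are bounded inductively. Hence such vertices keep their initial activity, and after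
-- i rounds every node of T_u reached along down-edges within depth 2^i either misses at most k·i
-- down-neighbours (each prune discards k children) or is a leaf of degree ≥ B, which with few paths
-- forces degree < 2d. In the layer assignment of T_v with a = k(s+1), a node labelled m then enters
-- a layer ≤ m by induction on m: its down-children enter earlier, and what remains (at most d
-- up-children and missing up-neighbours together, plus k·s missing down-neighbours) is at most a.
-- The depth 2^s > L covers every label.

{-# OPTIONS --safe #-}
module Submission where

open import Defs renaming (sym to adj-sym)
open import Data.Bool.ListAction using (any)
open import Data.Bool using (Bool; true; false; T; T?; _∧_; _∨_; not; if_then_else_)
open import Data.Bool.Properties using (T-≡; T-∧; T-not-≡; ∧-comm; ∧-identityʳ; ∧-zeroʳ)
open import Data.Empty using (⊥-elim)
open import Data.Fin using (_≟_)
open import Data.List using (List; []; _∷_; _++_; [_]; _∷ʳ_; length; map; concatMap; filterᵇ; allFin)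
open import Data.List.Properties
  using (length-map; length-++; map-++; map-cong; map-∘; map-id; filter-none; filter-++; filter-all; ∷-injective; ∷ʳ-injective)
open import Data.List.Membership.Propositional using (_∈_)
open import Data.List.Membership.Propositional.Properties
  using (∈-filter⁺; ∈-filter⁻; ∈-map⁺; ∈-map⁻; ∈-++⁺ˡ; ∈-++⁺ʳ; ∈-++⁻)
open import Data.List.Relation.Binary.Subset.Propositional using (_⊆_)
open import Data.List.Relation.Binary.Permutation.Propositional
  using (_↭_; ↭-refl; ↭-trans; ↭-sym; ↭-reflexive; ↭⇒↭ₛ)
import Data.List.Relation.Binary.Permutation.Setoid.Properties as ↭ₛ
open import Data.List.Relation.Binary.Permutation.Propositional.Properties
  using (filter-↭; ↭-length; ∈-resp-↭; All-resp-↭)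
import Data.List.Relation.Binary.Permutation.Propositional.Properties as ↭
open import Data.List.Relation.Unary.All as All using (All; []; _∷_)
import Data.List.Relation.Unary.All.Properties as All
open import Data.List.Relation.Unary.Any using (here; there; _─_)
open import Data.List.Relation.Unary.AllPairs as AllPairs using ([]; _∷_)
import Data.List.Relation.Unary.AllPairs.Properties as AllPairs
open import Data.List.Relation.Binary.Disjoint.Propositional using (Disjoint)
open import Data.List.Relation.Unary.Linked using (Linked; [-]; _∷_)
open import Data.List.Relation.Binary.Pointwise using (Pointwise; []; _∷_)
open import Data.List.Relation.Unary.Unique.Propositional using (Unique)
import Data.List.Relation.Unary.Unique.Propositional.Properties as Unique
open import Data.Nat
  using (ℕ; zero; suc; _+_; _*_; _^_; _≤_; _<_; _≤′_; ≤′-refl; ≤′-step; _<ᵇ_; z≤n; s≤s; s≤s⁻¹; >-nonZero)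
open import Data.Nat.ListAction using (sum)
open import Data.Nat.ListAction.Properties using (sum-++; sum-↭)
open import Data.Nat.Properties hiding (_≟_)
open import Algebra.Properties.CommutativeSemigroup +-commutativeSemigroup using (x∙yz≈y∙xz)
open import Data.Product using (∃; ∃-syntax; _×_; _,_; proj₁; proj₂)
open import Data.Sum using (_⊎_; inj₁; inj₂)
open import Function using (_∘_; Equivalence)
open import Relation.Binary.PropositionalEquality
  using (_≡_; _≢_; refl; sym; trans; cong; cong₂; subst; subst₂; setoid)
open import Relation.Nullary using (¬_; Dec; does; yes; no)

module _ {A : Set} where

  sum-map-─ : (g : A → ℕ) {x : A} {ys : List A} (x∈ys : x ∈ ys) →
              sum (map g ys) ≡ g x + sum (map g (ys ─ x∈ys))
  sum-map-─ g (here refl) = refl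
  sum-map-─ g {x} {y ∷ _} (there x∈ys) =
    trans (cong (g y +_) (sum-map-─ g x∈ys)) (x∙yz≈y∙xz (g y) (g x) _)

  ∈-─⁺ : ∀ {x z} {ys : List A} (x∈ys : x ∈ ys) → z ∈ ys → z ≢ x → z ∈ (ys ─ x∈ys)
  ∈-─⁺ (here refl) (here refl)  z≢x = ⊥-elim (z≢x refl)
  ∈-─⁺ (here refl) (there z∈ys) _   = z∈ys
  ∈-─⁺ (there _)   (here refl)  _   = here refl
  ∈-─⁺ (there x∈ys) (there z∈ys) z≢x = there (∈-─⁺ x∈ys z∈ys z≢x)

  Unique-++⁻ˡ : (xs : List A) {ys : List A} → Unique (xs ++ ys) → Unique xs
  Unique-++⁻ˡ []       _                  = []
  Unique-++⁻ˡ (x ∷ xs) (x∉ ∷ xs++ys!) = All.++⁻ˡ xs x∉ ∷ Unique-++⁻ˡ xs xs++ys!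

  sum-map-mono : {g h : A → ℕ} {xs : List A} → All (λ x → g x ≤ h x) xs → sum (map g xs) ≤ sum (map h xs)
  sum-map-mono []           = z≤n
  sum-map-mono (gx≤hx ∷ le) = +-mono-≤ gx≤hx (sum-map-mono le)

  ≤-sum-map : (g : A → ℕ) {x : A} {ys : List A} → x ∈ ys → g x ≤ sum (map g ys)
  ≤-sum-map g x∈ys = ≤-trans (m≤m+n _ _) (≤-reflexive (sym (sum-map-─ g x∈ys)))

  sum-map-mono-⊆ : (g : A → ℕ) {xs ys : List A} → Unique xs → xs ⊆ ys →
                   sum (map g xs) ≤ sum (map g ys)
  sum-map-mono-⊆ g {[]} _ _ = z≤n
  sum-map-mono-⊆ g {x ∷ xs} {ys} (x∉xs ∷ xs!) xs⊆ys = begin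
    g x + sum (map g xs)          ≤⟨ +-monoʳ-≤ (g x) (sum-map-mono-⊆ g xs! xs⊆ys─x) ⟩
    g x + sum (map g (ys ─ x∈ys)) ≡⟨ sym (sum-map-─ g x∈ys) ⟩
    sum (map g ys)                ∎
    where
    open ≤-Reasoning
    x∈ys = xs⊆ys (here refl)
    xs⊆ys─x : xs ⊆ (ys ─ x∈ys)
    xs⊆ys─x z∈xs = ∈-─⁺ x∈ys (xs⊆ys (there z∈xs)) (λ z≡x → All.lookup x∉xs z∈xs (sym z≡x))

  length≡sum-map-1 : (xs : List A) → length xs ≡ sum (map (λ _ → 1) xs)
  length≡sum-map-1 []       = refl
  length≡sum-map-1 (_ ∷ xs) = cong suc (length≡sum-map-1 xs)

  length-mono-⊆ : {xs ys : List A} → Unique xs → xs ⊆ ys → length xs ≤ length ys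
  length-mono-⊆ {xs} {ys} xs! xs⊆ys =
    subst₂ _≤_ (sym (length≡sum-map-1 xs)) (sym (length≡sum-map-1 ys)) (sum-map-mono-⊆ _ xs! xs⊆ys)

  sum-map-↭ : (g : A → ℕ) {xs ys : List A} → xs ↭ ys → sum (map g xs) ≡ sum (map g ys)
  sum-map-↭ g xs↭ys = sum-↭ (↭.map⁺ g xs↭ys)

  sum-map-++ : (g : A → ℕ) (xs ys : List A) → sum (map g (xs ++ ys)) ≡ sum (map g xs) + sum (map g ys)
  sum-map-++ g xs ys = trans (cong sum (map-++ g xs ys)) (sum-++ (map g xs) _)

  sum-map-≤-dominating : (g : A → ℕ) (xs ys : List A) → All (λ y → All (λ x → g x ≤ g y) xs) ys →
                         length xs ≤ length ys → sum (map g xs) ≤ sum (map g ys)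
  sum-map-≤-dominating g []       ys                     _ _ = z≤n
  sum-map-≤-dominating g (x ∷ xs) (y ∷ ys) ((gx≤gy ∷ _) ∷ dom) (s≤s #xs≤#ys) =
    +-mono-≤ gx≤gy (sum-map-≤-dominating g xs ys (All.map All.tail dom) #xs≤#ys)

  sum-map-filterᵇ-split : (g : A → ℕ) (p : A → Bool) (xs : List A) →
    sum (map g xs) ≡ sum (map g (filterᵇ p xs)) + sum (map g (filterᵇ (not ∘ p) xs))
  sum-map-filterᵇ-split g p [] = refl
  sum-map-filterᵇ-split g p (x ∷ xs) with p x
  ... | true  = trans (cong (g x +_) (sum-map-filterᵇ-split g p xs)) (sym (+-assoc (g x) _ _))
  ... | false = trans (cong (g x +_) (sum-map-filterᵇ-split g p xs))
                      (x∙yz≈y∙xz (g x) (sum (map g (filterᵇ p xs))) _)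

  length-filterᵇ-split : (p q : A → Bool) (xs : List A) →
    length (filterᵇ q xs) ≡
    length (filterᵇ (λ x → p x ∧ q x) xs) + length (filterᵇ (λ x → not (p x) ∧ q x) xs)
  length-filterᵇ-split p q [] = refl
  length-filterᵇ-split p q (x ∷ xs) with p x | q x
  ... | true  | true  = cong suc (length-filterᵇ-split p q xs)
  ... | true  | false = length-filterᵇ-split p q xs
  ... | false | true  = trans (cong suc (length-filterᵇ-split p q xs)) (sym (+-suc _ _))
  ... | false | false = length-filterᵇ-split p q xs

  length-filterᵇ-cong : {p q : A → Bool} → (∀ x → p x ≡ q x) → (xs : List A) →
                        length (filterᵇ p xs) ≡ length (filterᵇ q xs)
  length-filterᵇ-cong {p} {q} p≗q [] = refl
  length-filterᵇ-cong {p} {q} p≗q (x ∷ xs) with p x | q x | p≗q x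
  ... | true  | true  | _ = cong suc (length-filterᵇ-cong p≗q xs)
  ... | false | false | _ = length-filterᵇ-cong p≗q xs

  filterᵇ-↭-++ : (p : A → Bool) {xs ys zs : List A} →
                 xs ↭ ys ++ zs → filterᵇ p xs ↭ filterᵇ p ys ++ filterᵇ p zs
  filterᵇ-↭-++ p {ys = ys} {zs} xs↭ = ↭-trans (filter-↭ _ xs↭) (↭-reflexive (filter-++ _ ys zs))

  length-filterᵇ-partition : (p : A → Bool) (xs : List A) →
    length xs ≡ length (filterᵇ p xs) + length (filterᵇ (not ∘ p) xs)
  length-filterᵇ-partition p [] = refl
  length-filterᵇ-partition p (x ∷ xs) with p x
  ... | true  = cong suc (length-filterᵇ-partition p xs)
  ... | false = trans (cong suc (length-filterᵇ-partition p xs)) (sym (+-suc _ _))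

  -- The kept p-elements are outnumbered by the discarded ¬p-elements, each of which is heavier.
  sum-map-kept-≤ : (g : A → ℕ) (p : A → Bool) {xs kept disc : List A} →
    xs ↭ kept ++ disc → length (filterᵇ p xs) ≤ length disc →
    All (λ y → All (λ x → g x ≤ g y) kept) disc →
    sum (map g kept) ≤ sum (map g (filterᵇ (not ∘ p) xs))
  sum-map-kept-≤ g p {xs} {kept} {disc} xs↭ #p≤#disc heavy = begin
    sum (map g kept)
      ≡⟨ sum-map-filterᵇ-split g p kept ⟩
    sum (map g (filterᵇ p kept)) + sum (map g ¬p-kept)
      ≤⟨ +-monoˡ-≤ _ (sum-map-≤-dominating g _ _ ¬p-disc-heavy #p-kept≤#¬p-disc) ⟩
    sum (map g ¬p-disc) + sum (map g ¬p-kept)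
      ≡⟨ +-comm (sum (map g ¬p-disc)) _ ⟩
    sum (map g ¬p-kept) + sum (map g ¬p-disc)
      ≡⟨ sum-map-++ g ¬p-kept ¬p-disc ⟨
    sum (map g (¬p-kept ++ ¬p-disc))
      ≡⟨ sum-map-↭ g (filterᵇ-↭-++ (not ∘ p) {ys = kept} {disc} xs↭) ⟨
    sum (map g (filterᵇ (not ∘ p) xs)) ∎
    where
    open ≤-Reasoning
    ¬p-kept = filterᵇ (not ∘ p) kept
    ¬p-disc = filterᵇ (not ∘ p) disc
    ¬p-disc-heavy : All (λ y → All (λ x → g x ≤ g y) (filterᵇ p kept)) ¬p-disc
    ¬p-disc-heavy = All.filter⁺ _ (All.map (All.filter⁺ _) heavy)
    #p-kept≤#¬p-disc : length (filterᵇ p kept) ≤ length ¬p-disc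
    #p-kept≤#¬p-disc = +-cancelˡ-≤ (length (filterᵇ p disc)) _ _ (begin
      length (filterᵇ p disc) + length (filterᵇ p kept) ≡⟨ +-comm (length (filterᵇ p disc)) _ ⟩
      length (filterᵇ p kept) + length (filterᵇ p disc) ≡⟨ length-++ (filterᵇ p kept) ⟨
      length (filterᵇ p kept ++ filterᵇ p disc)         ≡⟨ ↭-length (filterᵇ-↭-++ p {ys = kept} {disc} xs↭) ⟨
      length (filterᵇ p xs)                             ≤⟨ #p≤#disc ⟩
      length disc                                       ≡⟨ length-filterᵇ-partition p disc ⟩
      length (filterᵇ p disc) + length ¬p-disc          ∎)

module _ {A : Set} (p : A → Bool) where

  ∈-filterᵇ⁺ : ∀ {x xs} → x ∈ xs → T (p x) → x ∈ filterᵇ p xs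
  ∈-filterᵇ⁺ = ∈-filter⁺ (T? ∘ p)

  ∈-filterᵇ⁻ : ∀ {x} xs → x ∈ filterᵇ p xs → x ∈ xs × T (p x)
  ∈-filterᵇ⁻ xs = ∈-filter⁻ (T? ∘ p) {xs = xs}

  All-filterᵇ⁺ : {Q : A → Set} {xs : List A} → All (λ x → T (p x) → Q x) xs → All Q (filterᵇ p xs)
  All-filterᵇ⁺ {xs = xs} h = All.zipWith (λ (q , t) → q t) (All.filter⁺ (T? ∘ p) h , All.all-filter (T? ∘ p) xs)

module _ {A B : Set} where

  length-concatMap : (F : A → List B) (xs : List A) → length (concatMap F xs) ≡ sum (map (length ∘ F) xs)
  length-concatMap F []       = refl
  length-concatMap F (x ∷ xs) = trans (length-++ (F x)) (cong (length (F x) +_) (length-concatMap F xs))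

  map-filterᵇ : (f : A → B) (p : B → Bool) (xs : List A) →
                map f (filterᵇ (p ∘ f) xs) ≡ filterᵇ p (map f xs)
  map-filterᵇ f p [] = refl
  map-filterᵇ f p (x ∷ xs) with p (f x)
  ... | true  = cong (f x ∷_) (map-filterᵇ f p xs)
  ... | false = map-filterᵇ f p xs

¬T⇒T-not : ∀ {b} → ¬ T b → T (not b)
¬T⇒T-not {false} _  = _
¬T⇒T-not {true}  ¬t = ¬t _

T-not⇒¬T : ∀ {b} → T (not b) → ¬ T b
T-not⇒¬T {false} _ ()

Pointwise-All : {A B : Set} {R : A → B → Set} {P : A → Set} {Q : B → Set} {xs : List A} {ys : List B} →
                Pointwise R xs ys → (∀ {x y} → R x y → P x → Q y) → All P xs → All Q ys
Pointwise-All []       _     []         = []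
Pointwise-All (r ∷ rs) R⇒P⇒Q (px ∷ pxs) = R⇒P⇒Q r px ∷ Pointwise-All rs R⇒P⇒Q pxs

Linked-∷ʳ : {A : Set} {R : A → A → Set} {x y : A} (xs : List A) →
            Linked R (xs ∷ʳ x) → R x y → Linked R (xs ∷ʳ x ∷ʳ y)
Linked-∷ʳ []           [-]          Rxy = Rxy ∷ [-]
Linked-∷ʳ (_ ∷ [])     (r ∷ [-])    Rxy = r ∷ Rxy ∷ [-]
Linked-∷ʳ (_ ∷ x ∷ xs) (r ∷ linked) Rxy = r ∷ Linked-∷ʳ (x ∷ xs) linked Rxy

<∞⇒≢∞ : ∀ {x y} → x <∞ y → x ≢ ∞
<∞⇒≢∞ {∞} () refl

≢∞⇒<∞∞ : ∀ {x} → x ≢ ∞ → x <∞ ∞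
≢∞⇒<∞∞ {fin _} _    = _
≢∞⇒<∞∞ {∞}     x≢∞ = x≢∞ refl

<∞-fin : ∀ {x m} → x <∞ fin m → ∃[ m′ ] x ≡ fin m′ × m′ < m
<∞-fin {fin m′} m′<m = m′ , refl , m′<m

<∞-<-pred : ∀ {x y f} → x <∞ y → y <∞ fin (suc f) → x <∞ fin f
<∞-<-pred {fin _} {fin _} a<b b<1+f = <-≤-trans a<b (s≤s⁻¹ b<1+f)

∃<∞fin : ∀ {x} → x ≢ ∞ → ∃[ f ] x <∞ fin f
∃<∞fin {fin m} _   = suc m , ≤-refl
∃<∞fin {∞}     x≢∞ = ⊥-elim (x≢∞ refl)

≤⇒<ᵇ≡false : ∀ {x y} → x ≤ y → (y <ᵇ x) ≡ false
≤⇒<ᵇ≡false x≤y = Equivalence.to T-not-≡ (¬T⇒T-not (λ y<ᵇx → <⇒≱ (<ᵇ⇒< _ _ y<ᵇx) x≤y))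

bit≤1 : ∀ b → (if b then 1 else 0) ≤ 1
bit≤1 true  = ≤-refl
bit≤1 false = z≤n

1≤exponent : ∀ {m L s} → 1 ≤ m → m ≤ L → L < 2 ^ s → 1 ≤ s
1≤exponent {s = zero}  1≤m m≤L (s≤s L≤0) = ≤-trans 1≤m (≤-trans m≤L L≤0)
1≤exponent {s = suc _} _   _   _          = s≤s z≤n

module LayerAssignment (G : Graph) (a : ℕ) where

  geq-anti : ∀ {j j′} x → j ≤′ j′ → geq G a j x ≡ false → geq G a j′ x ≡ false
  geq-anti x ≤′-refl          j-settled = j-settled
  geq-anti x (≤′-step j≤′j′) j-settled rewrite geq-anti x j≤′j′ j-settled = refl

  geq-suc-false : ∀ {j u cs} → countGeq G a j cs + missing G (node u cs) ≤ a →
                  geq G a (suc j) (node u cs) ≡ false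
  geq-suc-false {j} {u} {cs} in-Vj rewrite Equivalence.to T-≡ (≤⇒≤ᵇ in-Vj) =
    ∧-zeroʳ (geq G a j (node u cs))

  layer-≤ : ∀ {L m} x → geq G a m x ≡ false → m ≤ L → layer G a L x ≤∞ fin m
  layer-≤ {L} {m} x m-settled m≤L = go 0 L refl m≤L
    where
    closed : ∀ {j} → m ≤ j → geq G a j x ≢ true
    closed m≤j j-open with () ← trans (sym (geq-anti x (≤⇒≤′ m≤j) m-settled)) j-open
    go : ∀ j f → geq G a j x ≡ true → m ≤ j + f → layerAux G a x j f ≤∞ fin m
    go j zero j-open m≤j+0 = ⊥-elim (closed (subst (m ≤_) (+-identityʳ j) m≤j+0) j-open)
    go j (suc f) j-open m≤j+1+f with inV G a j x in inV-j
    ... | true  rewrite j-open = ≰⇒> (λ m≤j → closed m≤j j-open)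
    ... | false rewrite j-open =
      go (suc j) f (cong₂ (λ g i → g ∧ not i) j-open inV-j) (subst (m ≤_) (+-suc j f) m≤j+1+f)

module DownPaths (G : Graph) (ℓ : V G → ℕ∞) where

  isUp : V G → V G → Bool
  isUp u w = ℓ u ≤∞ᵇ ℓ w

  isDown : V G → V G → Bool
  isDown u w = not (isUp u w)

  downNbrs : V G → List (V G)
  downNbrs u = filterᵇ (isDown u) (nbrs G u)

  isDown⇒<∞ : ∀ {u w} → T (isDown u w) → ℓ w <∞ ℓ u
  isDown⇒<∞ {u} {w} down with ℓ u | ℓ w
  ... | fin a | fin b = ≰⇒> (λ a≤b → subst T (Equivalence.to T-not-≡ down) (≤⇒≤ᵇ a≤b))
  ... | ∞     | fin b = _

  nbrs-unique : ∀ u → Unique (nbrs G u)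
  nbrs-unique u = Unique.filter⁺ (T? ∘ adj G u) (Unique.allFin⁺ (n G))

  ∈-nbrs⇒adj : ∀ {u w} → w ∈ nbrs G u → adj G w u ≡ true
  ∈-nbrs⇒adj {u} {w} w∈ =
    trans (adj-sym G w u) (Equivalence.to T-≡ (proj₂ (∈-filterᵇ⁻ (adj G u) (allFin (n G)) w∈)))

  incPaths : ℕ → V G → List (List (V G))
  incPaths zero    u = [ [ u ] ]
  incPaths (suc f) u = [ u ] ∷ concatMap (λ w → map (_∷ʳ u) (incPaths f w)) (downNbrs u)

  #incPaths : ℕ → V G → ℕ
  #incPaths f u = length (incPaths f u)

  1≤#incPaths : ∀ f u → 1 ≤ #incPaths f u
  1≤#incPaths zero    u = s≤s z≤n
  1≤#incPaths (suc f) u = s≤s z≤n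

  #incPaths-suc : ∀ f u → #incPaths (suc f) u ≡ suc (sum (map (#incPaths f) (downNbrs u)))
  #incPaths-suc f u = cong suc (trans (length-concatMap _ (downNbrs u))
    (cong sum (map-cong (λ w → length-map (_∷ʳ u) (incPaths f w)) (downNbrs u))))

  #incPaths-1 : ∀ u → #incPaths 1 u ≡ suc (length (downNbrs u))
  #incPaths-1 u = trans (#incPaths-suc 0 u) (cong suc (sym (length≡sum-map-1 (downNbrs u))))

  #incPaths-down : ∀ f {u w} → w ∈ downNbrs u → #incPaths f w ≤ #incPaths (suc f) u
  #incPaths-down f {u} w∈ =
    ≤-trans (≤-sum-map (#incPaths f) w∈) (≤-trans (n≤1+n _) (≤-reflexive (sym (#incPaths-suc f u))))

  incPaths-end : ∀ f u → All (λ p → ∃[ q ] p ≡ q ∷ʳ u) (incPaths f u)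
  incPaths-end zero    u = ([] , refl) ∷ []
  incPaths-end (suc f) u = ([] , refl) ∷ All.concat⁺ (All.map⁺ (All.universal
    (λ w → All.map⁺ (All.universal (λ p → p , refl) (incPaths f w))) (downNbrs u)))

  incPaths-disjoint : ∀ f u {w w′} → w ≢ w′ →
    Disjoint (map (_∷ʳ u) (incPaths f w)) (map (_∷ʳ u) (incPaths f w′))
  incPaths-disjoint f u {w} {w′} w≢w′ (v∈ , v∈′)
    with p , p∈ , refl ← ∈-map⁻ (_∷ʳ u) v∈ | p′ , p′∈ , p∷ʳu≡p′∷ʳu ← ∈-map⁻ (_∷ʳ u) v∈′
    with q , refl ← All.lookup (incPaths-end f w) p∈ | q′ , refl ← All.lookup (incPaths-end f w′) p′∈
    = w≢w′ (proj₂ (∷ʳ-injective q q′ (proj₁ (∷ʳ-injective _ _ p∷ʳu≡p′∷ʳu))))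

  incPaths-unique : ∀ f u → Unique (incPaths f u)
  incPaths-unique zero    u = [] ∷ []
  incPaths-unique (suc f) u = All.concat⁺ (All.map⁺ (All.universal
      (λ w → All.map⁺ (All.map (λ { (q , refl) → [u]≢ q }) (incPaths-end f w))) (downNbrs u)))
    ∷ Unique.concat⁺
        (All.map⁺ (All.universal (λ w → Unique.map⁺ ∷ʳ-injectiveˡ (incPaths-unique f w)) (downNbrs u)))
        (AllPairs.map⁺ (AllPairs.map (incPaths-disjoint f u) downNbrs-unique))
    where
    [u]≢ : ∀ {w} q → [ u ] ≢ q ∷ʳ w ∷ʳ u
    [u]≢ q eq with ∷ʳ-injective [] (q ∷ʳ _) eq
    [u]≢ []      eq | ()
    [u]≢ (_ ∷ _) eq | ()
    ∷ʳ-injectiveˡ : ∀ {p p′} → p ∷ʳ u ≡ p′ ∷ʳ u → p ≡ p′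
    ∷ʳ-injectiveˡ = proj₁ ∘ ∷ʳ-injective _ _
    downNbrs-unique : Unique (downNbrs u)
    downNbrs-unique = Unique.filter⁺ (T? ∘ isDown u) (nbrs-unique u)

  trivialPath : ∀ {u} → ℓ u ≢ ∞ → IsIncPathTo G ℓ [ u ] u
  trivialPath ℓu≢∞ = ([] , refl) , [-] , ≢∞⇒<∞∞ ℓu≢∞

  incPaths-sound : ∀ f u → ℓ u ≢ ∞ → All (λ p → IsIncPathTo G ℓ p u) (incPaths f u)
  incPaths-sound zero    u ℓu≢∞ = trivialPath ℓu≢∞ ∷ []
  incPaths-sound (suc f) u ℓu≢∞ = trivialPath ℓu≢∞ ∷ All.concat⁺ (All.map⁺ (All.tabulate extend))
    where
    extend : ∀ {w} → w ∈ downNbrs u → All (λ p → IsIncPathTo G ℓ p u) (map (_∷ʳ u) (incPaths f w))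
    extend {w} w∈ = All.map⁺ (All.map extendPath (incPaths-sound f w (<∞⇒≢∞ w<u)))
      where
      w∈nbrs = proj₁ (∈-filterᵇ⁻ (isDown u) (nbrs G u) w∈)
      w<u = isDown⇒<∞ (proj₂ (∈-filterᵇ⁻ (isDown u) (nbrs G u) w∈))
      extendPath : ∀ {p} → IsIncPathTo G ℓ p w → IsIncPathTo G ℓ (p ∷ʳ u) u
      extendPath ((q , refl) , increasing , _) =
        (q ∷ʳ w , refl) , Linked-∷ʳ q increasing (∈-nbrs⇒adj w∈nbrs , w<u) , ≢∞⇒<∞∞ ℓu≢∞

  #incPaths≤NumPathsIn : ∀ {v N} → ℓ v ≢ ∞ → NumPathsIn≡ G ℓ v N → ∀ f → #incPaths f v ≤ N
  #incPaths≤NumPathsIn {v} ℓv≢∞ (ps , _ , ∈ps⇔ , refl) f =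
    length-mono-⊆ (incPaths-unique f v)
      (λ {p} p∈ → Equivalence.from (∈ps⇔ p) (All.lookup (incPaths-sound f v ℓv≢∞) p∈))

module Pruning (G : Graph) (ℓ : V G → ℕ∞) (d : ℕ)
  (up-deg : ∀ v → ℓ v ≢ ∞ → length (filterᵇ (λ u → ℓ v ≤∞ᵇ ℓ u) (nbrs G v)) ≤ d)
  (B k : ℕ) (d≤k : d ≤ k) where

  open DownPaths G ℓ

  Tr : Set
  Tr = Tree (n G)

  deg : V G → ℕ
  deg u = length (nbrs G u)

  -- NumPathsIn(u) ≤ √B, in a form inherited by down-neighbours.
  FewPaths : V G → Set
  FewPaths u = ℓ u ≢ ∞ × (∀ f → #incPaths f u * #incPaths f u ≤ B)

  FewPaths-down : ∀ {u w} → FewPaths u → w ∈ downNbrs u → FewPaths w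
  FewPaths-down (_ , bound) w∈ =
    <∞⇒≢∞ (isDown⇒<∞ (proj₂ (∈-filterᵇ⁻ (isDown _) (nbrs G _) w∈))) ,
    λ f → let w≤u = #incPaths-down f w∈ in ≤-trans (*-mono-≤ w≤u w≤u) (bound (suc f))

  DistinctNbrs : V G → List Tr → Set
  DistinctNbrs u cs = Unique (map root cs) × map root cs ⊆ nbrs G u

  DistinctNbrs-roots : ∀ {u cs cs′} → map root cs ≡ map root cs′ →
                       DistinctNbrs u cs → DistinctNbrs u cs′
  DistinctNbrs-roots {u} roots≡ = subst (λ rs → Unique rs × rs ⊆ nbrs G u) roots≡

  data WellMapped : Tr → Set where
    wellMapped : ∀ {u cs} → DistinctNbrs u cs → All WellMapped cs → WellMapped (node u cs)

  sizes≡sum-map-size : (cs : List Tr) → sizes cs ≡ sum (map size cs)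
  sizes≡sum-map-size []       = refl
  sizes≡sum-map-size (c ∷ cs) = cong (size c +_) (sizes≡sum-map-size cs)

  prune-root : ∀ {T P : Tr} → LocalPrune k T P → root P ≡ root T
  prune-root (few _)          = refl
  prune-root (many _ _ _ _ _) = refl

  prune-roots : ∀ {cs ps : List Tr} → Pointwise (LocalPrune k) cs ps → map root ps ≡ map root cs
  prune-roots []       = refl
  prune-roots (r ∷ rs) = cong₂ _∷_ (prune-root r) (prune-roots rs)

  prune-leaf : ∀ {u} {P : Tr} → LocalPrune k (node u []) P → P ≡ node u []
  prune-leaf (few _)          = refl
  prune-leaf (many () _ _ _ _)

  roots-kept : ∀ {ps kept disc : List Tr} → ps ↭ kept ++ disc → map root ps ↭ map root kept ++ map root disc
  roots-kept {kept = kept} {disc} ps↭ = ↭-trans (↭.map⁺ root ps↭) (↭-reflexive (map-++ root kept disc))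

  DistinctNbrs-kept : ∀ {u ps kept disc} → ps ↭ kept ++ disc → DistinctNbrs u ps → DistinctNbrs u kept
  DistinctNbrs-kept {kept = kept} {disc} ps↭ (roots! , roots⊆) =
    Unique-++⁻ˡ (map root kept) (↭ₛ.Unique-resp-↭ (setoid (V G)) (↭⇒↭ₛ roots↭) roots!) ,
    λ r∈ → roots⊆ (∈-resp-↭ (↭-sym roots↭) (∈-++⁺ˡ r∈))
    where roots↭ = roots-kept {kept = kept} {disc} ps↭

  leaf-wellMapped : ∀ {u} → WellMapped (node u [])
  leaf-wellMapped = wellMapped ([] , λ ()) []

  mutual
    prune-wellMapped : ∀ {T P : Tr} → LocalPrune k T P → WellMapped T → WellMapped P
    prune-wellMapped (few _) _ = leaf-wellMapped
    prune-wellMapped (many {kept = kept} _ pw ps↭ _ _) (wellMapped distinct cs-wm) =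
      wellMapped (DistinctNbrs-kept ps↭ (DistinctNbrs-roots (sym (prune-roots pw)) distinct))
                 (All.++⁻ˡ kept (All-resp-↭ ps↭ (prunes-wellMapped pw cs-wm)))

    prunes-wellMapped : ∀ {cs ps : List Tr} → Pointwise (LocalPrune k) cs ps →
                        All WellMapped cs → All WellMapped ps
    prunes-wellMapped []       []           = []
    prunes-wellMapped (r ∷ rs) (wm ∷ wms) = prune-wellMapped r wm ∷ prunes-wellMapped rs wms

  isChild : List Tr → V G → Bool
  isChild cs w = any (λ c → does (root c ≟ w)) cs

  isChild⇒∈ : ∀ cs {w} → T (isChild cs w) → w ∈ map root cs
  isChild⇒∈ (c ∷ cs) {w} child with root c ≟ w
  ... | yes refl = here refl
  ... | no  _    = there (isChild⇒∈ cs child)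

  ∈⇒isChild : ∀ cs {w} → w ∈ map root cs → T (isChild cs w)
  ∈⇒isChild (c ∷ cs) {w} w∈ with root c ≟ w
  ∈⇒isChild (c ∷ cs) _            | yes _   = _
  ∈⇒isChild (c ∷ cs) (here refl)  | no r≢w = ⊥-elim (r≢w refl)
  ∈⇒isChild (c ∷ cs) (there w∈)   | no _   = ∈⇒isChild cs w∈

  isChild-roots : ∀ {cs cs′} → map root cs ≡ map root cs′ → ∀ w → isChild cs w ≡ isChild cs′ w
  isChild-roots {[]}     {[]}       _     w = refl
  isChild-roots {c ∷ cs} {c′ ∷ cs′} roots≡ w =
    cong₂ (λ r b → does (r ≟ w) ∨ b) (proj₁ (∷-injective roots≡))
          (isChild-roots (proj₂ (∷-injective roots≡)) w)

  missingUp missingDown : V G → List Tr → ℕ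
  missingUp   u cs = length (filterᵇ (λ w → isUp u w ∧ not (isChild cs w)) (nbrs G u))
  missingDown u cs = length (filterᵇ (λ w → isDown u w ∧ not (isChild cs w)) (nbrs G u))

  missing-split : ∀ u cs → missing G (node u cs) ≡ missingUp u cs + missingDown u cs
  missing-split u cs = length-filterᵇ-split (isUp u) (not ∘ isChild cs) (nbrs G u)

  missing-leaf : ∀ u → missing G (node u []) ≡ deg u
  missing-leaf u = cong length (filter-all (T? ∘ λ _ → true) (All.universal _ (nbrs G u)))

  missingDown-roots : ∀ u {cs cs′} → map root cs ≡ map root cs′ → missingDown u cs ≡ missingDown u cs′
  missingDown-roots u roots≡ =
    length-filterᵇ-cong (λ w → cong (λ b → isDown u w ∧ not b) (isChild-roots roots≡ w)) (nbrs G u)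

  #upChildren : V G → List Tr → ℕ
  #upChildren u cs = length (filterᵇ (isUp u ∘ root) cs)

  -- Up-children and missing up-neighbours are distinct up-neighbours of u.
  #upChildren+missingUp≤d : ∀ {u cs} → ℓ u ≢ ∞ → DistinctNbrs u cs →
                            #upChildren u cs + missingUp u cs ≤ d
  #upChildren+missingUp≤d {u} {cs} ℓu≢∞ (roots! , roots⊆) = begin
    #upChildren u cs + missingUp u cs
      ≤⟨ +-monoˡ-≤ _ #upChildren≤ ⟩
    length (filterᵇ (λ w → isChild cs w ∧ isUp u w) N) + missingUp u cs
      ≡⟨ cong (length (filterᵇ (λ w → isChild cs w ∧ isUp u w) N) +_)
              (length-filterᵇ-cong (λ w → ∧-comm (isUp u w) _) N) ⟩
    length (filterᵇ (λ w → isChild cs w ∧ isUp u w) N) +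
    length (filterᵇ (λ w → not (isChild cs w) ∧ isUp u w) N)
      ≡⟨ length-filterᵇ-split (isChild cs) (isUp u) N ⟨
    length (filterᵇ (isUp u) N)
      ≤⟨ up-deg u ℓu≢∞ ⟩
    d ∎
    where
    open ≤-Reasoning
    N = nbrs G u
    up-roots⊆ : filterᵇ (isUp u) (map root cs) ⊆ filterᵇ (λ w → isChild cs w ∧ isUp u w) N
    up-roots⊆ w∈ = let w∈roots , up = ∈-filterᵇ⁻ (isUp u) (map root cs) w∈ in
      ∈-filterᵇ⁺ _ (roots⊆ w∈roots) (Equivalence.from T-∧ (∈⇒isChild cs w∈roots , up))
    #upChildren≤ : #upChildren u cs ≤ length (filterᵇ (λ w → isChild cs w ∧ isUp u w) N)
    #upChildren≤ = begin
      #upChildren u cs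
        ≡⟨ length-map root (filterᵇ (isUp u ∘ root) cs) ⟨
      length (map root (filterᵇ (isUp u ∘ root) cs))
        ≡⟨ cong length (map-filterᵇ root (isUp u) cs) ⟩
      length (filterᵇ (isUp u) (map root cs))
        ≤⟨ length-mono-⊆ (Unique.filter⁺ (T? ∘ isUp u) roots!) up-roots⊆ ⟩
      length (filterᵇ (λ w → isChild cs w ∧ isUp u w) N) ∎

  -- A down-neighbour missing below the kept children was a root of a discarded child or already missing.
  missingDown-kept : ∀ u {cs ps kept disc : List Tr} → map root ps ≡ map root cs → ps ↭ kept ++ disc →
                     missingDown u kept ≤ missingDown u cs + length disc
  missingDown-kept u {cs} {ps} {kept} {disc} roots≡ ps↭ = begin
    missingDown u kept
      ≤⟨ length-mono-⊆ (Unique.filter⁺ (T? ∘ _) (nbrs-unique u)) missing⊆ ⟩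
    length (filterᵇ (missingDownOf cs) N ++ filterᵇ (isChild disc) N)
      ≡⟨ length-++ (filterᵇ (missingDownOf cs) N) ⟩
    missingDown u cs + length (filterᵇ (isChild disc) N)
      ≤⟨ +-monoʳ-≤ (missingDown u cs) #disc-roots≤ ⟩
    missingDown u cs + length disc ∎
    where
    open ≤-Reasoning
    N = nbrs G u
    missingDownOf : List Tr → V G → Bool
    missingDownOf xs w = isDown u w ∧ not (isChild xs w)
    roots↭ = roots-kept {kept = kept} {disc} ps↭
    missing⊆ : filterᵇ (missingDownOf kept) N ⊆ filterᵇ (missingDownOf cs) N ++ filterᵇ (isChild disc) N
    missing⊆ {w} w∈ = from-cs-or-disc (T? (isChild cs w))
      where
      w∈N,t = ∈-filterᵇ⁻ (missingDownOf kept) N w∈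
      w∈N = proj₁ w∈N,t
      down,¬kept-child = Equivalence.to T-∧ (proj₂ w∈N,t)
      from-cs-or-disc : Dec (T (isChild cs w)) → w ∈ filterᵇ (missingDownOf cs) N ++ filterᵇ (isChild disc) N
      from-cs-or-disc (no ¬child) =
        ∈-++⁺ˡ (∈-filterᵇ⁺ _ w∈N (Equivalence.from T-∧ (proj₁ down,¬kept-child , ¬T⇒T-not ¬child)))
      from-cs-or-disc (yes child)
        with ∈-++⁻ (map root kept) (∈-resp-↭ roots↭ (subst (w ∈_) (sym roots≡) (isChild⇒∈ cs child)))
      ... | inj₁ w∈kept = ⊥-elim (T-not⇒¬T (proj₂ down,¬kept-child) (∈⇒isChild kept w∈kept))
      ... | inj₂ w∈disc =
        ∈-++⁺ʳ (filterᵇ (missingDownOf cs) N) (∈-filterᵇ⁺ _ w∈N (∈⇒isChild disc w∈disc))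
    #disc-roots≤ : length (filterᵇ (isChild disc) N) ≤ length disc
    #disc-roots≤ = begin
      length (filterᵇ (isChild disc) N)
        ≤⟨ length-mono-⊆ (Unique.filter⁺ (T? ∘ isChild disc) (nbrs-unique u))
                         (λ w∈ → isChild⇒∈ disc (proj₂ (∈-filterᵇ⁻ _ N w∈))) ⟩
      length (map root disc) ≡⟨ length-map root disc ⟩
      length disc ∎

  sum-map-downChildren≤ : ∀ (g : V G → ℕ) {u} ps → DistinctNbrs u ps →
                          sum (map (g ∘ root) (filterᵇ (isDown u ∘ root) ps)) ≤ sum (map g (downNbrs u))
  sum-map-downChildren≤ g {u} ps (roots! , roots⊆) = begin
    sum (map (g ∘ root) (filterᵇ (isDown u ∘ root) ps))
      ≡⟨ cong sum (map-∘ (filterᵇ (isDown u ∘ root) ps)) ⟩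
    sum (map g (map root (filterᵇ (isDown u ∘ root) ps)))
      ≡⟨ cong (sum ∘ map g) (map-filterᵇ root (isDown u) ps) ⟩
    sum (map g (filterᵇ (isDown u) (map root ps)))
      ≤⟨ sum-map-mono-⊆ g (Unique.filter⁺ (T? ∘ isDown u) roots!) down⊆ ⟩
    sum (map g (downNbrs u)) ∎
    where
    open ≤-Reasoning
    down⊆ : filterᵇ (isDown u) (map root ps) ⊆ downNbrs u
    down⊆ w∈ = let w∈roots , down = ∈-filterᵇ⁻ (isDown u) (map root ps) w∈ in
               ∈-filterᵇ⁺ (isDown u) (roots⊆ w∈roots) down

  prune-size : ∀ f {T P : Tr} → LocalPrune k T P → WellMapped T → ℓ (root T) <∞ fin f →
               size P ≤ #incPaths f (root T)
  prune-size f {node u _} (few _) _ _ = 1≤#incPaths f u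
  prune-size zero (many _ _ _ _ _) _ u<0 with _ , _ , () ← <∞-fin u<0
  prune-size (suc f) {node u cs} (many {ps = ps} {kept} {disc} _ pw ps↭ #disc≡k heavy)
             (wellMapped distinct cs-wm) u<1+f = begin
    suc (sizes kept)
      ≡⟨ cong suc (sizes≡sum-map-size kept) ⟩
    suc (sum (map size kept))
      ≤⟨ s≤s (sum-map-kept-≤ size (isUp u ∘ root) ps↭ #up≤#disc heavy) ⟩
    suc (sum (map size downPs))
      ≤⟨ s≤s (sum-map-mono (All-filterᵇ⁺ (isDown u ∘ root) downChildren-size)) ⟩
    suc (sum (map (#incPaths f ∘ root) downPs))
      ≤⟨ s≤s (sum-map-downChildren≤ (#incPaths f) ps distinctPs) ⟩
    suc (sum (map (#incPaths f) (downNbrs u)))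
      ≡⟨ #incPaths-suc f u ⟨
    #incPaths (suc f) u ∎
    where
    open ≤-Reasoning
    downPs = filterᵇ (isDown u ∘ root) ps
    distinctPs : DistinctNbrs u ps
    distinctPs = DistinctNbrs-roots (sym (prune-roots pw)) distinct
    #up≤#disc : #upChildren u ps ≤ length disc
    #up≤#disc = ≤-trans (m+n≤o⇒m≤o _ (#upChildren+missingUp≤d (<∞⇒≢∞ u<1+f) distinctPs))
                        (≤-trans d≤k (≤-reflexive (sym #disc≡k)))
    downChildren-size : All (λ p → T (isDown u (root p)) → size p ≤ #incPaths f (root p)) ps
    downChildren-size = Pointwise-All pw
      (λ {c} r c-wm down → subst (λ w → size _ ≤ #incPaths f w) (sym (prune-root r))
         (prune-size f r c-wm (<∞-<-pred (isDown⇒<∞ (subst (T ∘ isDown u) (prune-root r) down)) u<1+f)))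
      cs-wm

  FewMissing : ℕ → ℕ → Tr → Set
  FewMissing t zero    (node u cs) = cs ≡ []
  FewMissing t (suc D) (node u cs) =
      (missingDown u cs ≤ k * t × All (λ c → T (isDown u (root c)) → FewMissing t D c) cs)
    ⊎ (cs ≡ [] × B ≤ deg u)

  GoodChild : ℕ → ℕ → V G → Tr → Set
  GoodChild t D u c = WellMapped c × (T (isDown u (root c)) → FewPaths (root c) × FewMissing t D c)

  goodChildren : ∀ {t D u cs} → FewPaths u → WellMapped (node u cs) →
                 All (λ c → T (isDown u (root c)) → FewMissing t D c) cs → All (GoodChild t D u) cs
  goodChildren {u = u} u-few (wellMapped (_ , roots⊆) cs-wm) down =
    All.zip (cs-wm , All.tabulate child-good)
    where
    child-good : ∀ {c} → c ∈ _ → T (isDown u (root c)) → FewPaths (root c) × FewMissing _ _ c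
    child-good c∈ c-down =
      FewPaths-down u-few (∈-filterᵇ⁺ (isDown u) (roots⊆ (∈-map⁺ root c∈)) c-down) , All.lookup down c∈ c-down

  highDegLeaf-fewMissing : ∀ {u} → B ≤ deg u → ∀ t D → FewMissing t D (node u [])
  highDegLeaf-fewMissing _    t zero    = refl
  highDegLeaf-fewMissing B≤deg t (suc D) = inj₂ (refl , B≤deg)

  ≤k*t+≤k : ∀ t {x y} → x ≤ k * t → y ≤ k → x + y ≤ k * suc t
  ≤k*t+≤k t x≤kt y≤k =
    ≤-trans (+-mono-≤ x≤kt y≤k) (≤-reflexive (trans (+-comm (k * t) k) (sym (*-suc k t))))

  prune-fewMissing : ∀ {T P : Tr} → LocalPrune k T P → ∀ t D → FewMissing t D T → FewMissing (suc t) D P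
  prune-fewMissing (few _)           t zero    _                     = refl
  prune-fewMissing (many () _ _ _ _) t zero    refl
  prune-fewMissing (few _)           t (suc D) (inj₂ (refl , B≤deg)) = inj₂ (refl , B≤deg)
  prune-fewMissing (many () _ _ _ _) t (suc D) (inj₂ (refl , _))
  prune-fewMissing {node u cs} (few #cs≤k) t (suc D) (inj₁ (few-missing , _)) =
    inj₁ (≤-trans (missingDown-kept u {ps = cs} {kept = []} refl ↭-refl) (≤k*t+≤k t few-missing #cs≤k) ,
          [])
  prune-fewMissing {node u cs} (many {kept = kept} {disc} _ pw ps↭ #disc≡k _) t (suc D)
                   (inj₁ (few-missing , down)) =
    inj₁ (≤-trans (missingDown-kept u {kept = kept} {disc} (prune-roots pw) ps↭)
                  (≤k*t+≤k t few-missing (≤-reflexive #disc≡k)) ,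
          All.++⁻ˡ kept (All-resp-↭ ps↭ (Pointwise-All pw
            (λ r c-few p-down → prune-fewMissing r t D (c-few (subst (T ∘ isDown u) (prune-root r) p-down)))
            down)))

  module Attaching (act : V G → Bool) (P : V G → Tr) (root-P : ∀ w → root (P w) ≡ w) where

    attach-root : ∀ D T → root (attach act P D T) ≡ root T
    attach-root zero    (node u []) with act u
    ... | true  = root-P u
    ... | false = refl
    attach-root zero    (node u (_ ∷ _)) = refl
    attach-root (suc D) (node u cs)      = refl

    attachs-roots : ∀ D cs → map root (attachs act P D cs) ≡ map root cs
    attachs-roots D []       = refl
    attachs-roots D (c ∷ cs) = cong₂ _∷_ (attach-root D c) (attachs-roots D cs)

    All-attachs : ∀ {Q R : Tr → Set} D {cs} →
                  (∀ {c} → Q c → R (attach act P D c)) → All Q cs → All R (attachs act P D cs)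
    All-attachs D Q⇒R []       = []
    All-attachs D Q⇒R (q ∷ qs) = Q⇒R q ∷ All-attachs D Q⇒R qs

    attach-wellMapped : (∀ w → WellMapped (P w)) → ∀ D {T} → WellMapped T → WellMapped (attach act P D T)
    attach-wellMapped P-wm zero {node u []} wm with act u
    ... | true  = P-wm u
    ... | false = wm
    attach-wellMapped P-wm zero    {node u (_ ∷ _)} wm = wm
    attach-wellMapped P-wm (suc D) {node u cs} (wellMapped distinct cs-wm) =
      wellMapped (DistinctNbrs-roots (sym (attachs-roots D cs)) distinct)
                 (All-attachs D (attach-wellMapped P-wm D) cs-wm)

    attach-fewMissing : ∀ t E →
      (∀ w → FewPaths w → (act w ≡ true → FewMissing t E (P w)) × (act w ≡ false → B ≤ deg w)) →
      ∀ D {T} → WellMapped T → FewPaths (root T) → FewMissing t D T →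
      FewMissing t (D + E) (attach act P D T)
    attach-fewMissing t E grafts zero {node u []} _ u-few refl with act u in act-u
    ... | true  = proj₁ (grafts u u-few) act-u
    ... | false = highDegLeaf-fewMissing (proj₂ (grafts u u-few) act-u) t E
    attach-fewMissing t E grafts (suc D) {node u []} _ _ (inj₂ (refl , B≤deg)) = inj₂ (refl , B≤deg)
    attach-fewMissing t E grafts (suc D) {node u cs} u-wm u-few (inj₁ (few-missing , down)) =
      inj₁ (subst (_≤ k * t) (missingDown-roots u (sym (attachs-roots D cs))) few-missing ,
            All-attachs D attach-child (goodChildren u-few u-wm down))
      where
      attach-child : ∀ {c} → GoodChild t D u c →
                     T (isDown u (root (attach act P D c))) → FewMissing t (D + E) (attach act P D c)
      attach-child {c} (c-wm , c-good) c′-down =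
        let c-fewPaths , c-few = c-good (subst (T ∘ isDown u) (attach-root D c) c′-down) in
        attach-fewMissing t E grafts D c-wm c-fewPaths c-few

  roots-leaves : (ws : List (V G)) → map root (map (λ w → node w []) ws) ≡ ws
  roots-leaves ws = trans (sym (map-∘ ws)) (map-id ws)

  initTree-root : ∀ v → root (initTree G B v) ≡ v
  initTree-root v with length (nbrs G v) <ᵇ B
  ... | true  = refl
  ... | false = refl

  initTree-wellMapped : ∀ v → WellMapped (initTree G B v)
  initTree-wellMapped v with length (nbrs G v) <ᵇ B
  ... | false = leaf-wellMapped
  ... | true  = wellMapped (subst Unique (sym (roots-leaves (nbrs G v))) (nbrs-unique v) ,
                            subst (_⊆ nbrs G v) (sym (roots-leaves (nbrs G v))) (λ w∈ → w∈))
                           (All.map⁺ (All.universal (λ _ → leaf-wellMapped) (nbrs G v)))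

  initTree-fewMissing : ∀ v → FewMissing 0 1 (initTree G B v)
  initTree-fewMissing v with length (nbrs G v) <ᵇ B in deg<B
  ... | false = inj₂ (refl , ≮⇒≥ (λ deg<B′ → subst T deg<B (<⇒<ᵇ deg<B′)))
  ... | true  = inj₁ (≤-trans (≤-reflexive (cong length (filter-none (T? ∘ _) none-missing))) z≤n ,
                      All.map⁺ (All.universal (λ _ _ → refl) (nbrs G v)))
    where
    leaves = map (λ w → node w []) (nbrs G v)
    none-missing : All (λ w → ¬ T (isDown v w ∧ not (isChild leaves w))) (nbrs G v)
    none-missing = All.tabulate (λ {w} w∈ missing → T-not⇒¬T (proj₂ (Equivalence.to T-∧ missing))
                     (∈⇒isChild leaves (subst (w ∈_) (sym (roots-leaves (nbrs G v))) w∈)))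

  initTree-inactive : ∀ v → initActive G B v ≡ false → B ≤ deg v × initTree G B v ≡ node v []
  initTree-inactive v inactive with length (nbrs G v) <ᵇ B in deg<B
  ... | false = ≮⇒≥ (λ deg<B′ → subst T deg<B (<⇒<ᵇ deg<B′)) , refl

  record Invariant (i : ℕ) (Ts : V G → Tr) (act : V G → Bool) : Set where
    field
      root-Ts       : ∀ u → root (Ts u) ≡ u
      wellMapped-Ts : ∀ u → WellMapped (Ts u)
      fewMissing-Ts : ∀ u → FewPaths u → FewMissing i (2 ^ i) (Ts u)
      inactive-Ts   : ∀ u → FewPaths u → act u ≡ false → B ≤ deg u × Ts u ≡ node u []

  invariant-init : Invariant 0 (initTree G B) (initActive G B)
  invariant-init = record
    { root-Ts       = initTree-root
    ; wellMapped-Ts = initTree-wellMapped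
    ; fewMissing-Ts = λ u _ → initTree-fewMissing u
    ; inactive-Ts   = λ u _ → initTree-inactive u
    }

  module Round {i : ℕ} {Ts : V G → Tr} {act : V G → Bool} (inv : Invariant i Ts act)
               (P : V G → Tr) (prunes : ∀ v → LocalPrune k (Ts v) (P v)) where

    open Invariant inv

    act′ : V G → Bool
    act′ = newActive G B act P

    new : V G → Tr
    new w = if act′ w then attach act′ P (2 ^ i) (P w) else P w

    root-P : ∀ w → root (P w) ≡ w
    root-P w = trans (prune-root (prunes w)) (root-Ts w)

    open Attaching act′ P root-P

    P-wm : ∀ w → WellMapped (P w)
    P-wm w = prune-wellMapped (prunes w) (wellMapped-Ts w)

    P-few : ∀ w → FewPaths w → FewMissing (suc i) (2 ^ i) (P w)
    P-few w w-few = prune-fewMissing (prunes w) i (2 ^ i) (fewMissing-Ts w w-few)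

    act′≡act : ∀ w → FewPaths w → act′ w ≡ act w
    act′≡act w (ℓw≢∞ , bound) =
      trans (cong (λ b → act w ∧ not b) (≤⇒<ᵇ≡false (≤-trans (*-mono-≤ size≤ size≤) (bound f))))
            (∧-identityʳ (act w))
      where
      f = proj₁ (∃<∞fin ℓw≢∞)
      size≤ : size (P w) ≤ #incPaths f w
      size≤ = subst (λ x → size (P w) ≤ #incPaths f x) (root-Ts w)
                (prune-size f (prunes w) (wellMapped-Ts w)
                   (subst (λ x → ℓ x <∞ fin f) (sym (root-Ts w)) (proj₂ (∃<∞fin ℓw≢∞))))

    P-inactive : ∀ w → FewPaths w → act′ w ≡ false → B ≤ deg w × P w ≡ node w []
    P-inactive w w-few off with B≤deg , Ts≡leaf ← inactive-Ts w w-few (trans (sym (act′≡act w w-few)) off) =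
      B≤deg , prune-leaf (subst (λ T → LocalPrune k T (P w)) Ts≡leaf (prunes w))

    grafts : ∀ w → FewPaths w →
             (act′ w ≡ true → FewMissing (suc i) (2 ^ i) (P w)) × (act′ w ≡ false → B ≤ deg w)
    grafts w w-few = (λ _ → P-few w w-few) , (proj₁ ∘ P-inactive w w-few)

    new-root : ∀ w → root (new w) ≡ w
    new-root w with act′ w
    ... | true  = trans (attach-root (2 ^ i) (P w)) (root-P w)
    ... | false = root-P w

    new-wellMapped : ∀ w → WellMapped (new w)
    new-wellMapped w with act′ w
    ... | true  = attach-wellMapped P-wm (2 ^ i) (P-wm w)
    ... | false = P-wm w

    new-fewMissing : ∀ w → FewPaths w → FewMissing (suc i) (2 ^ suc i) (new w)
    new-fewMissing w w-few with act′ w in on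
    ... | true  = subst (λ D → FewMissing (suc i) D (attach act′ P (2 ^ i) (P w)))
                        (cong (2 ^ i +_) (sym (+-identityʳ (2 ^ i))))
                        (attach-fewMissing (suc i) (2 ^ i) grafts (2 ^ i) (P-wm w)
                           (subst FewPaths (sym (root-P w)) w-few) (P-few w w-few))
    ... | false = let B≤deg , P≡leaf = P-inactive w w-few on in
                  subst (FewMissing (suc i) (2 ^ suc i)) (sym P≡leaf) (highDegLeaf-fewMissing B≤deg (suc i) (2 ^ suc i))

    new-inactive : ∀ w → FewPaths w → act′ w ≡ false → B ≤ deg w × new w ≡ node w []
    new-inactive w w-few off rewrite off = P-inactive w w-few off

  invariant-step : ∀ {i Ts act} (inv : Invariant i Ts act)
                   (P : V G → Tr) (prunes : ∀ v → LocalPrune k (Ts v) (P v)) →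
                   Invariant (suc i) (Round.new inv P prunes) (Round.act′ inv P prunes)
  invariant-step inv P prunes = record
    { root-Ts       = new-root
    ; wellMapped-Ts = new-wellMapped
    ; fewMissing-Ts = new-fewMissing
    ; inactive-Ts   = new-inactive
    }
    where open Round inv P prunes

  invariant : ∀ {i Ts act} → ExpLP G B k i Ts act → Invariant i Ts act
  invariant init                 = invariant-init
  invariant (step run P prunes) = invariant-step (invariant run) P prunes

  -- (1 + #down)² = #incPaths 1 u ² ≤ B ≤ deg u ≤ d + #down forces #down < d.
  highDeg-deg≤d+d : ∀ {u} → FewPaths u → B ≤ deg u → deg u ≤ d + d
  highDeg-deg≤d+d {u} (ℓu≢∞ , bound) B≤deg = ≤-trans deg≤d+#down (+-monoʳ-≤ d (<⇒≤ #down<d))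
    where
    open ≤-Reasoning
    #down = length (downNbrs u)
    deg≤d+#down : deg u ≤ d + #down
    deg≤d+#down = begin
      deg u                                              ≡⟨ length-filterᵇ-partition (isUp u) (nbrs G u) ⟩
      length (filterᵇ (isUp u) (nbrs G u)) + #down       ≤⟨ +-monoˡ-≤ #down (up-deg u ℓu≢∞) ⟩
      d + #down                                          ∎
    #down<d : #down < d
    #down<d = +-cancelʳ-≤ #down (suc #down) d (begin
      suc #down + #down                 ≤⟨ +-monoʳ-≤ (suc #down) (m≤m*n #down (suc #down)) ⟩
      suc #down * suc #down             ≡⟨ cong (λ x → x * x) (#incPaths-1 u) ⟨
      #incPaths 1 u * #incPaths 1 u     ≤⟨ bound 1 ⟩
      B                                 ≤⟨ B≤deg ⟩
      deg u                             ≤⟨ deg≤d+#down ⟩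
      d + #down                         ∎)

  module Settling (ℓ-pos : ∀ v m → ℓ v ≡ fin m → 1 ≤ m) (s : ℕ) (1≤s : 1 ≤ s) where

    a : ℕ
    a = k * suc s

    open LayerAssignment G a

    d+d≤a : d + d ≤ a
    d+d≤a = begin
      d + d     ≤⟨ +-mono-≤ d≤k (≤-trans d≤k (m≤m*n k s {{>-nonZero 1≤s}})) ⟩
      k + k * s ≡⟨ *-suc k s ⟨
      a         ∎
      where open ≤-Reasoning

    countGeq≤#upChildren : ∀ {j u} cs → All (λ c → T (isDown u (root c)) → geq G a j c ≡ false) cs →
                           countGeq G a j cs ≤ #upChildren u cs
    countGeq≤#upChildren [] [] = z≤n
    countGeq≤#upChildren {j} {u} (c ∷ cs) (c-settled ∷ cs-settled) with isUp u (root c)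
    ... | true  = +-mono-≤ (bit≤1 (geq G a j c)) (countGeq≤#upChildren cs cs-settled)
    ... | false rewrite c-settled _ = countGeq≤#upChildren cs cs-settled

    settled : ∀ D {T m} → WellMapped T → FewPaths (root T) → FewMissing s D T → ℓ (root T) ≡ fin m → m ≤ D →
              geq G a m T ≡ false
    settled D {node u _} {zero} _ _ _ ℓu≡0 _ with () ← ℓ-pos u 0 ℓu≡0
    settled zero {m = suc _} _ _ _ _ ()
    settled (suc D) {node u cs} {suc j} _ u-few (inj₂ (refl , B≤deg)) _ _ =
      geq-suc-false {j} {u} {[]}
        (subst (_≤ a) (sym (missing-leaf u)) (≤-trans (highDeg-deg≤d+d u-few B≤deg) d+d≤a))
    settled (suc D) {node u cs} {suc j} u-wm@(wellMapped distinct _) u-few (inj₁ (few-missing , down))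
            ℓu≡1+j (s≤s j≤D) =
      geq-suc-false {j} {u} {cs} (begin
        countGeq G a j cs + missing G (node u cs)
          ≤⟨ +-mono-≤ (countGeq≤#upChildren cs down-settled) (≤-reflexive (missing-split u cs)) ⟩
        #upChildren u cs + (missingUp u cs + missingDown u cs)
          ≡⟨ +-assoc (#upChildren u cs) _ _ ⟨
        #upChildren u cs + missingUp u cs + missingDown u cs
          ≤⟨ +-mono-≤ (#upChildren+missingUp≤d (proj₁ u-few) distinct) few-missing ⟩
        d + k * s
          ≤⟨ +-monoˡ-≤ (k * s) d≤k ⟩
        k + k * s
          ≡⟨ *-suc k s ⟨
        a ∎)
      where
      open ≤-Reasoning
      settle-child : ∀ {c} → GoodChild s D u c → T (isDown u (root c)) → geq G a j c ≡ false
      settle-child {c} (c-wm , c-good) c-down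
        with m′ , ℓc≡m′ , s≤s m′≤j ← <∞-fin (subst (ℓ (root c) <∞_) ℓu≡1+j (isDown⇒<∞ c-down))
        with c-fewPaths , c-few ← c-good c-down =
        geq-anti c (≤⇒≤′ m′≤j) (settled D c-wm c-fewPaths c-few ℓc≡m′ (≤-trans m′≤j j≤D))
      down-settled : All (λ c → T (isDown u (root c)) → geq G a j c ≡ false) cs
      down-settled = All.map settle-child (goodChildren u-few u-wm down)

    layer-≤-ℓ : ∀ {L Ts act} → Invariant s Ts act → ∀ {v m} → FewPaths v → ℓ v ≡ fin m → m ≤ L → L < 2 ^ s →
                layer G a L (Ts v) ≤∞ fin m
    layer-≤-ℓ {Ts = Ts} inv {v} {m} v-few ℓv≡m m≤L L<2^s = layer-≤ (Ts v) root-settled m≤L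
      where
      open Invariant inv
      root-settled : geq G a m (Ts v) ≡ false
      root-settled = settled (2 ^ s) (wellMapped-Ts v) (subst FewPaths (sym (root-Ts v)) v-few) (fewMissing-Ts v v-few)
                       (subst (λ w → ℓ w ≡ fin m) (sym (root-Ts v)) ℓv≡m) (≤-trans m≤L (<⇒≤ L<2^s))

mainTheorem10 : (G : Graph) (d L : ℕ) (ℓ : V G → ℕ∞) →
    (∀ v m → ℓ v ≡ fin m → (1 ≤ m) × (m ≤ L)) →
    (∀ v → ℓ v ≢ ∞ → length (filterᵇ (λ u → ℓ v ≤∞ᵇ ℓ u) (nbrs G v)) ≤ d) →
    (B k s : ℕ) → d ≤ k → L < 2 ^ s →
    (v : V G) → ℓ v ≢ ∞ →
    (∃ λ N → NumPathsIn≡ G ℓ v N × (N * N ≤ B)) →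
    (Ts : V G → Tree (n G)) (act : V G → Bool) → ExpLP G B k s Ts act →
    layer G (k * suc s) L (Ts v) ≤∞ ℓ v
mainTheorem10 G d L ℓ ℓ-range up-deg B k s d≤k L<2^s v ℓv≢∞ (N , paths , N²≤B) Ts act run =
  layer-≤-ℓv (ℓ v) refl
  where
  open DownPaths G ℓ
  open Pruning G ℓ d up-deg B k d≤k
  v-few : FewPaths v
  v-few = ℓv≢∞ , λ f → let ≤N = #incPaths≤NumPathsIn ℓv≢∞ paths f in ≤-trans (*-mono-≤ ≤N ≤N) N²≤B
  layer-≤-ℓv : ∀ x → ℓ v ≡ x → layer G (k * suc s) L (Ts v) ≤∞ x
  layer-≤-ℓv ∞       ℓv≡∞ = ⊥-elim (ℓv≢∞ ℓv≡∞)
  layer-≤-ℓv (fin m) ℓv≡m = layer-≤-ℓ (invariant run) v-few ℓv≡m m≤L L<2^s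
    where
    1≤m = proj₁ (ℓ-range v m ℓv≡m)
    m≤L = proj₂ (ℓ-range v m ℓv≡m)
    open Settling (λ u m′ → proj₁ ∘ ℓ-range u m′) s (1≤exponent 1≤m m≤L L<2^s)
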